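{- Let $K$ be an algebraically closed field of characteristic $0$, let $f\in K[t]$ be a polynomial of degree $d\geq 2$, and let $D\geq 1$ be an integer. Let $L(t)\in K((1/t))$ satisfy $v_\infty(L)=D$ and $L(t^d)=f(L(t))$. Then there exists $\psi\in K((1/t))$ with $v_\infty(\psi)=1$, $\psi(t^d)=f(\psi(t))$, and $L(t)=\psi(t^D)$.
   Context: $K((1/t))$ is the field of formal Laurent series $\sum_{k\le N} c_k t^k$ in $1/t$. For a nonzero such series, $v_\infty$ denotes the largest exponent $k$ with $c_k\neq 0$ (so $v_\infty(t)=1$). -}

module Defs where

open import Level using (Level; _⊔_) renaming (suc to lsuc)
open import Algebra.Bundles using (CommutativeRing)
open import Data.Nat as ℕ using (ℕ; zero; suc)
import Data.Nat.DivMod as ℕD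
open import Data.Integer as ℤ using (ℤ; +_; -[1+_])
open import Data.List using (List; []; _∷_)
open import Data.Product using (∃; _×_)
open import Relation.Nullary using (¬_; yes; no)
open import Relation.Binary.PropositionalEquality using (_≡_)

record Field (c ℓ : Level) : Set (lsuc (c ⊔ ℓ)) where
  field
    commutativeRing : CommutativeRing c ℓ
  open CommutativeRing commutativeRing public
  field
    nontrivial : ¬ (1# ≈ 0#)
    inverse    : ∀ x → ¬ (x ≈ 0#) → ∃ λ y → x * y ≈ 1#

module Over {c ℓ : Level} (K : Field c ℓ) where
  open Field K using (Carrier; _≈_; _+_; _*_; 0#; 1#)

  -- Polynomials over K: coefficient lists, lowest degree first.
  Poly : Set c
  Poly = List Carrier

  evalK : Poly → Carrier → Carrier
  evalK []       x = 0#
  evalK (a ∷ as) x = a + x * evalK as x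

  -- HasDegree p n : p has exactly n+1 coefficients and nonzero leading one.
  HasDegree : Poly → ℕ → Set ℓ
  HasDegree []            _       = ¬ (0# ≈ 0#)
  HasDegree (a ∷ [])      zero    = ¬ (a ≈ 0#)
  HasDegree (a ∷ [])      (suc n) = ¬ (0# ≈ 0#)
  HasDegree (a ∷ b ∷ as)  zero    = ¬ (0# ≈ 0#)
  HasDegree (a ∷ b ∷ as)  (suc n) = HasDegree (b ∷ as) n

  AlgClosed : Set (c ⊔ ℓ)
  AlgClosed = ∀ (p : Poly) (n : ℕ) → HasDegree p (suc n) → ∃ λ x → evalK p x ≈ 0#

  ι : ℕ → Carrier
  ι zero    = 0#
  ι (suc n) = 1# + ι n

  CharZero : Set ℓ
  CharZero = ∀ (n : ℕ) → ¬ (ι (suc n) ≈ 0#)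

  -- Formal Laurent series in 1/t:  top N with coefficients a gives
  --   Σ_{n ≥ 0} a n · t^(N - n).
  record Series : Set c where
    constructor series
    field
      top : ℤ
      cf  : ℕ → Carrier
  open Series public

  coeff : Series → ℤ → Carrier
  coeff (series N a) k with N ℤ.- k
  ... | + n      = a n
  ... | -[1+ _ ] = 0#

  _≋_ : Series → Series → Set ℓ
  s ≋ s′ = ∀ k → coeff s k ≈ coeff s′ k

  -- v∞ s ≡ D (for nonzero s): coefficient of t^D nonzero, all higher vanish.
  V∞ : Series → ℤ → Set ℓ
  V∞ s D = ¬ (coeff s D ≈ 0#) × (∀ k → D ℤ.< k → coeff s k ≈ 0#)

  sumUpTo : (ℕ → Carrier) → ℕ → Carrier
  sumUpTo g zero    = g zero
  sumUpTo g (suc n) = sumUpTo g n + g (suc n)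

  constS : Carrier → Series
  constS x = series (+ 0) λ { zero → x ; (suc _) → 0# }

  zeroS : Series
  zeroS = constS 0#

  _+S_ : Series → Series → Series
  s +S s′ = series M λ n → coeff s (M ℤ.- + n) + coeff s′ (M ℤ.- + n)
    where M = top s ℤ.⊔ top s′

  _*S_ : Series → Series → Series
  series N a *S series N′ b = series (N ℤ.+ N′) λ n → sumUpTo (λ i → a i * b (n ℕ.∸ i)) n

  evalS : Poly → Series → Series
  evalS []       s = zeroS
  evalS (a ∷ as) s = constS a +S (s *S evalS as s)

  -- s(t^d) for d ≥ 1 (for d = 0 this returns the zero series as junk; only
  -- used with d ≥ 1).
  compPow : Series → ℕ → Series
  compPow s zero = zeroS
  compPow (series N a) (suc e) = series (+ suc e ℤ.* N) g
    where
      g : ℕ → Carrier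
      g n with n ℕD.% suc e ℕ.≟ 0
      ... | yes _ = a (n ℕD./ suc e)
      ... | no  _ = 0#

-- Write L = Σₙ lₙ t^(D−n) with l₀ ≠ 0, and let n be a non-multiple of D such that lᵢ = 0 for all
-- smaller non-multiples i. Compare the coefficients of t^(dD−n) in L(t^d) = f(L). On the left it is
-- l_(n/d) or 0, and l_(n/d) vanishes because n/d < n is again not a multiple of D. On the right, every
-- product of coefficients of L landing there involves an index that is not a multiple of D; all such
-- products vanish except those containing lₙ itself, which add up to d·c·l₀^(d−1)·lₙ with c the leading
-- coefficient of f. In characteristic 0 this forces lₙ = 0. Hence L = ψ(t^D) for ψ = Σₘ l_(mD) t^(1−m),
-- and since t ↦ t^D is an injective ring homomorphism commuting with t ↦ t^d, the equation descends to ψ.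

module Submission where

open import Defs
open import Level using (Level)
open import Algebra.Bundles using (Semiring)
open import Data.Nat as ℕ using (ℕ; zero; suc; _≤_; z≤n; s≤s)
import Data.Nat.Properties as ℕP
open import Data.Nat.Divisibility
  using (_∣_; _∣?_; divides; divides-refl; m%n≡0⇒n∣m; _∣0; n∣m*n; ∣m⇒∣m*n; ∣m+n∣m⇒∣n; ∣m∸n∣n⇒∣m; ∣⇒≤)
import Data.Nat.DivMod as ℕD
open import Data.Nat.Induction using (<-rec)
open import Data.Integer as ℤ using (ℤ; +_; -[1+_])
import Data.Integer.Properties as ℤP
open import Data.Integer.Tactic.RingSolver using (solve-∀)
open import Data.Product using (∃; _×_; _,_; proj₁; proj₂; Σ)
open import Data.Sum using (_⊎_; inj₁; inj₂)
open import Data.Empty using (⊥-elim)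
open import Data.List using ([]; _∷_)
open import Relation.Nullary using (¬_; yes; no)
open import Relation.Binary.PropositionalEquality as ≡ using (_≡_; _≢_)

i-[i-j]≡j : ∀ i j → i ℤ.- (i ℤ.- j) ≡ j
i-[i-j]≡j = solve-∀

below-or-above : ∀ B k → (Σ ℕ λ i → k ≡ B ℤ.- + i) ⊎ (Σ ℕ λ j → k ≡ B ℤ.+ + suc j)
below-or-above B k with B ℤ.- k in eq
... | + i      = inj₁ (i , ≡.trans (≡.sym (i-[i-j]≡j B k)) (≡.cong (λ x → B ℤ.- x) eq))
... | -[1+ j ] = inj₂ (j , ≡.trans (≡.sym (i-[i-j]≡j B k)) (≡.cong (λ x → B ℤ.- x) eq))

≤⇒≡+ : ∀ {i j} → i ℤ.≤ j → Σ ℕ λ k → j ≡ i ℤ.+ + k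
≤⇒≡+ {i} {j} i≤j = ℤ.∣ j ℤ.- i ∣ , (begin
  j                      ≡⟨ i≡j+[i-j] j i ⟩
  i ℤ.+ (j ℤ.- i)        ≡⟨ ≡.cong (λ x → i ℤ.+ x) (≡.sym (ℤP.0≤i⇒+∣i∣≡i (ℤP.i≤j⇒0≤j-i i≤j))) ⟩
  i ℤ.+ + ℤ.∣ j ℤ.- i ∣  ∎)
  where
  open ≡.≡-Reasoning
  i≡j+[i-j] : ∀ i j → i ≡ j ℤ.+ (i ℤ.- j)
  i≡j+[i-j] = solve-∀

<⇒≡+suc : ∀ {i j} → i ℤ.< j → Σ ℕ λ k → j ≡ i ℤ.+ + suc k
<⇒≡+suc {i} i<j with ≤⇒≡+ (ℤP.i<j⇒suc[i]≤j i<j)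
... | k , ≡.refl = k , [1+i]+k≡i+[1+k] i (+ k)
  where
  [1+i]+k≡i+[1+k] : ∀ i k → (ℤ.+ 1 ℤ.+ i) ℤ.+ k ≡ i ℤ.+ (ℤ.+ 1 ℤ.+ k)
  [1+i]+k≡i+[1+k] = solve-∀

common-upper-bound : ∀ A B → Σ ℕ λ a → Σ ℕ λ b → A ℤ.+ + a ≡ B ℤ.+ + b
common-upper-bound A B with below-or-above A B
... | inj₁ (i , ≡.refl) = 0 , i , i+0≡[i-j]+j A (+ i)
  where
  i+0≡[i-j]+j : ∀ i j → i ℤ.+ ℤ.+ 0 ≡ (i ℤ.- j) ℤ.+ j
  i+0≡[i-j]+j = solve-∀
... | inj₂ (j , ≡.refl) = suc j , 0 , ≡.sym (ℤP.+-identityʳ _)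

m*n*o≡m*o*n : ∀ m n o → m ℕ.* n ℕ.* o ≡ m ℕ.* o ℕ.* n
m*n*o≡m*o*n m n o = ≡.trans (ℕP.*-assoc m n o) (≡.trans (≡.cong (m ℕ.*_) (ℕP.*-comm n o)) (≡.sym (ℕP.*-assoc m o n)))

<⊎≡+ : ∀ i c → i ℕ.< c ⊎ Σ ℕ λ m → i ≡ m ℕ.+ c
<⊎≡+ i c with i ℕ.<? c
... | yes i<c = inj₁ i<c
... | no  i≮c = inj₂ (i ℕ.∸ c , ≡.sym (ℕP.m∸n+n≡m (ℕP.≮⇒≥ i≮c)))

module Laurent {c ℓ : Level} (K : Field c ℓ) where
  open Field K
  open Over K
  open import Algebra.Definitions.RawSemiring (Semiring.rawSemiring semiring) using (_^_)
  open import Relation.Binary.Reasoning.Setoid setoid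
  import Algebra.Solver.Ring.NaturalCoefficients.Default commutativeSemiring as Solver
  open Solver using (_:*_; _:+_; _:=_)

  x*y≈0⇒y≈0 : ∀ {x y} → ¬ (x ≈ 0#) → x * y ≈ 0# → y ≈ 0#
  x*y≈0⇒y≈0 {x} {y} x≉0 xy≈0 with inverse x x≉0
  ... | x⁻¹ , xx⁻¹≈1 = begin
    y               ≈⟨ sym (*-identityˡ y) ⟩
    1# * y          ≈⟨ *-congʳ (sym xx⁻¹≈1) ⟩
    (x * x⁻¹) * y   ≈⟨ Solver.solve 3 (λ x x⁻¹ y → (x :* x⁻¹) :* y := x⁻¹ :* (x :* y)) refl x x⁻¹ y ⟩
    x⁻¹ * (x * y)   ≈⟨ *-congˡ xy≈0 ⟩
    x⁻¹ * 0#        ≈⟨ zeroʳ x⁻¹ ⟩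
    0#              ∎

  *-≉0 : ∀ {x y} → ¬ (x ≈ 0#) → ¬ (y ≈ 0#) → ¬ (x * y ≈ 0#)
  *-≉0 x≉0 y≉0 xy≈0 = y≉0 (x*y≈0⇒y≈0 x≉0 xy≈0)

  ^-≉0 : ∀ {x} n → ¬ (x ≈ 0#) → ¬ (x ^ n ≈ 0#)
  ^-≉0 zero    x≉0 = nontrivial
  ^-≉0 (suc n) x≉0 = *-≉0 x≉0 (^-≉0 n x≉0)

  sumUpTo-cong : ∀ {g h} n → (∀ i → i ≤ n → g i ≈ h i) → sumUpTo g n ≈ sumUpTo h n
  sumUpTo-cong zero    g≈h = g≈h 0 z≤n
  sumUpTo-cong (suc n) g≈h = +-cong (sumUpTo-cong n (λ i i≤n → g≈h i (ℕP.m≤n⇒m≤1+n i≤n))) (g≈h (suc n) ℕP.≤-refl)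

  sumUpTo-zero : ∀ {g} n → (∀ i → i ≤ n → g i ≈ 0#) → sumUpTo g n ≈ 0#
  sumUpTo-zero zero    g≈0 = g≈0 0 z≤n
  sumUpTo-zero (suc n) g≈0 =
    trans (+-cong (sumUpTo-zero n (λ i i≤n → g≈0 i (ℕP.m≤n⇒m≤1+n i≤n))) (g≈0 (suc n) ℕP.≤-refl)) (+-identityˡ 0#)

  sumUpTo-last : ∀ {g} n → (∀ i → i ℕ.< n → g i ≈ 0#) → sumUpTo g n ≈ g n
  sumUpTo-last zero    _   = refl
  sumUpTo-last (suc n) g≈0 = trans (+-congʳ (sumUpTo-zero n (λ i i≤n → g≈0 i (s≤s i≤n)))) (+-identityˡ _)

  sumUpTo-first : ∀ {g} n → (∀ i → 1 ≤ i → i ≤ n → g i ≈ 0#) → sumUpTo g n ≈ g 0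
  sumUpTo-first zero    _   = refl
  sumUpTo-first (suc n) g≈0 = trans (+-cong (sumUpTo-first n (λ i 1≤i i≤n → g≈0 i 1≤i (ℕP.m≤n⇒m≤1+n i≤n)))
                                            (g≈0 (suc n) (s≤s z≤n) ℕP.≤-refl))
                                    (+-identityʳ _)

  sumUpTo-ends : ∀ {g} n → 1 ≤ n → (∀ i → 1 ≤ i → i ℕ.< n → g i ≈ 0#) → sumUpTo g n ≈ g 0 + g n
  sumUpTo-ends (suc n) _ g≈0 = +-congʳ (sumUpTo-first n (λ i 1≤i i≤n → g≈0 i 1≤i (s≤s i≤n)))

  sumUpTo-+ : ∀ {g} m n → sumUpTo g (m ℕ.+ suc n) ≈ sumUpTo g m + sumUpTo (λ i → g (m ℕ.+ suc i)) n
  sumUpTo-+ {g} m zero    = trans (reflexive (≡.cong (sumUpTo g) (ℕP.+-comm m 1)))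
                                  (+-congˡ (reflexive (≡.cong g (ℕP.+-comm 1 m))))
  sumUpTo-+ {g} m (suc n) = begin
    sumUpTo g (m ℕ.+ suc (suc n))
      ≡⟨ ≡.cong (sumUpTo g) (ℕP.+-suc m (suc n)) ⟩
    sumUpTo g (m ℕ.+ suc n) + g (suc (m ℕ.+ suc n))
      ≈⟨ +-cong (sumUpTo-+ m n) (reflexive (≡.cong g (≡.sym (ℕP.+-suc m (suc n))))) ⟩
    (sumUpTo g m + sumUpTo (λ i → g (m ℕ.+ suc i)) n) + g (m ℕ.+ suc (suc n))
      ≈⟨ +-assoc _ _ _ ⟩
    sumUpTo g m + sumUpTo (λ i → g (m ℕ.+ suc i)) (suc n)
      ∎

  sumUpTo-dropInitial : ∀ {g} c m → (∀ i → i ℕ.< c → g i ≈ 0#) →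
                        sumUpTo g (m ℕ.+ c) ≈ sumUpTo (λ i → g (i ℕ.+ c)) m
  sumUpTo-dropInitial c zero    g≈0 = sumUpTo-last c g≈0
  sumUpTo-dropInitial c (suc m) g≈0 = +-congʳ (sumUpTo-dropInitial c m g≈0)

  sumUpTo-dropFinal : ∀ {g} c m → (∀ i → m ℕ.< i → i ≤ m ℕ.+ c → g i ≈ 0#) →
                      sumUpTo g (m ℕ.+ c) ≈ sumUpTo g m
  sumUpTo-dropFinal {g} zero    m _   = reflexive (≡.cong (sumUpTo g) (ℕP.+-identityʳ m))
  sumUpTo-dropFinal {g} (suc c) m g≈0 = begin
    sumUpTo g (m ℕ.+ suc c)                   ≡⟨ ≡.cong (sumUpTo g) (ℕP.+-suc m c) ⟩
    sumUpTo g (m ℕ.+ c) + g (suc (m ℕ.+ c))   ≈⟨ +-cong (sumUpTo-dropFinal c m earlier≈0) last≈0 ⟩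
    sumUpTo g m + 0#                          ≈⟨ +-identityʳ _ ⟩
    sumUpTo g m                               ∎
    where
    earlier≈0 : ∀ i → m ℕ.< i → i ≤ m ℕ.+ c → g i ≈ 0#
    earlier≈0 i m<i i≤m+c = g≈0 i m<i (ℕP.≤-trans i≤m+c (ℕP.+-monoʳ-≤ m (ℕP.n≤1+n c)))
    last≈0 : g (suc (m ℕ.+ c)) ≈ 0#
    last≈0 = g≈0 _ (s≤s (ℕP.m≤m+n m c)) (ℕP.≤-reflexive (≡.sym (ℕP.+-suc m c)))

  Seq : Set c
  Seq = ℕ → Carrier

  infixl 7 _⊛_
  _⊛_ : Seq → Seq → Seq
  (u ⊛ v) n = sumUpTo (λ i → u i * v (n ℕ.∸ i)) n

  ⊛-cong : ∀ {u u′ v v′} → (∀ i → u i ≈ u′ i) → (∀ i → v i ≈ v′ i) → ∀ n → (u ⊛ v) n ≈ (u′ ⊛ v′) n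
  ⊛-cong u≈u′ v≈v′ n = sumUpTo-cong n (λ i _ → *-cong (u≈u′ i) (v≈v′ _))

  ⊛-zeroBelow : ∀ {u v} a b j → (∀ i → i ℕ.< a → u i ≈ 0#) → (∀ i → i ℕ.< b → v i ≈ 0#) →
                j ℕ.< a ℕ.+ b → (u ⊛ v) j ≈ 0#
  ⊛-zeroBelow {u} {v} a b j u≈0 v≈0 j<a+b = sumUpTo-zero j term≈0
    where
    term≈0 : ∀ i → i ≤ j → u i * v (j ℕ.∸ i) ≈ 0#
    term≈0 i i≤j with i ℕ.<? a
    ... | yes i<a = trans (*-congʳ (u≈0 i i<a)) (zeroˡ _)
    ... | no  i≮a = trans (*-congˡ (v≈0 _ j∸i<b)) (zeroʳ _)
      where
      j∸i<b : j ℕ.∸ i ℕ.< b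
      j∸i<b = ℕP.+-cancelˡ-< i _ _ (≡.subst (ℕ._< i ℕ.+ b) (≡.sym (ℕP.m+[n∸m]≡n i≤j))
                (ℕP.<-≤-trans j<a+b (ℕP.+-monoˡ-≤ b (ℕP.≮⇒≥ i≮a))))

  ⊛-dropˡ : ∀ {u v} c m → (∀ i → i ℕ.< c → u i ≈ 0#) → (u ⊛ v) (m ℕ.+ c) ≈ ((λ i → u (i ℕ.+ c)) ⊛ v) m
  ⊛-dropˡ {u} {v} c m u≈0 =
    trans (sumUpTo-dropInitial c m (λ i i<c → trans (*-congʳ (u≈0 i i<c)) (zeroˡ _)))
          (sumUpTo-cong m (λ i _ → *-congˡ (reflexive (≡.cong v ([m+c]∸[i+c]≡m∸i i)))))
    where
    [m+c]∸[i+c]≡m∸i : ∀ i → (m ℕ.+ c) ℕ.∸ (i ℕ.+ c) ≡ m ℕ.∸ i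
    [m+c]∸[i+c]≡m∸i i = ≡.trans (≡.cong₂ ℕ._∸_ (ℕP.+-comm m c) (ℕP.+-comm i c)) (ℕP.[m+n]∸[m+o]≡n∸o c m i)

  ⊛-dropʳ : ∀ {u v} c m → (∀ i → i ℕ.< c → v i ≈ 0#) → (u ⊛ v) (m ℕ.+ c) ≈ (u ⊛ (λ i → v (i ℕ.+ c))) m
  ⊛-dropʳ {u} {v} c m v≈0 =
    trans (sumUpTo-dropFinal c m late≈0)
          (sumUpTo-cong m (λ i i≤m → *-congˡ (reflexive (≡.cong v (ℕP.+-∸-comm c i≤m)))))
    where
    late≈0 : ∀ i → m ℕ.< i → i ≤ m ℕ.+ c → u i * v ((m ℕ.+ c) ℕ.∸ i) ≈ 0#
    late≈0 i m<i i≤m+c = trans (*-congˡ (v≈0 _ m+c∸i<c)) (zeroʳ _)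
      where
      m+c∸i<c : (m ℕ.+ c) ℕ.∸ i ℕ.< c
      m+c∸i<c = ℕP.<-≤-trans (ℕP.∸-monoʳ-< m<i i≤m+c) (ℕP.≤-reflexive (ℕP.m+n∸m≡n m c))

  IsShift : ℕ → Seq → Seq → Set ℓ
  IsShift c w u = (∀ i → i ℕ.< c → w i ≈ 0#) × (∀ m → w (m ℕ.+ c) ≈ u m)

  isShift-unique : ∀ {c w w′ u} → IsShift c w u → IsShift c w′ u → ∀ i → w i ≈ w′ i
  isShift-unique {c} (w≈0 , w≈u) (w′≈0 , w′≈u) i with <⊎≡+ i c
  ... | inj₁ i<c          = trans (w≈0 i i<c) (sym (w′≈0 i i<c))
  ... | inj₂ (m , ≡.refl) = trans (w≈u m) (sym (w′≈u m))

  ⊛-isShift : ∀ {c d w u z v} → IsShift c w u → IsShift d z v → IsShift (c ℕ.+ d) (w ⊛ z) (u ⊛ v)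
  ⊛-isShift {c} {d} {w} {u} {z} {v} (w≈0 , w≈u) (z≈0 , z≈v) = (λ j → ⊛-zeroBelow c d j w≈0 z≈0) , shifted
    where
    shifted : ∀ m → (w ⊛ z) (m ℕ.+ (c ℕ.+ d)) ≈ (u ⊛ v) m
    shifted m = begin
      (w ⊛ z) (m ℕ.+ (c ℕ.+ d))               ≡⟨ ≡.cong (w ⊛ z) (≡.trans (ℕP.+-comm m (c ℕ.+ d)) (ℕP.+-assoc c d m)) ⟩
      (w ⊛ z) (c ℕ.+ (d ℕ.+ m))               ≡⟨ ≡.cong (w ⊛ z) (ℕP.+-comm c (d ℕ.+ m)) ⟩
      (w ⊛ z) ((d ℕ.+ m) ℕ.+ c)               ≈⟨ ⊛-dropˡ {v = z} c (d ℕ.+ m) w≈0 ⟩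
      ((λ i → w (i ℕ.+ c)) ⊛ z) (d ℕ.+ m)     ≡⟨ ≡.cong ((λ i → w (i ℕ.+ c)) ⊛ z) (ℕP.+-comm d m) ⟩
      ((λ i → w (i ℕ.+ c)) ⊛ z) (m ℕ.+ d)     ≈⟨ ⊛-dropʳ {u = λ i → w (i ℕ.+ c)} d m z≈0 ⟩
      ((λ i → w (i ℕ.+ c)) ⊛ (λ i → z (i ℕ.+ d))) m ≈⟨ ⊛-cong w≈u z≈v m ⟩
      (u ⊛ v) m                               ∎

  IsStretch : ℕ → Seq → Seq → Set ℓ
  IsStretch k w u = (∀ m → w (m ℕ.* k) ≈ u m) × (∀ j → ¬ (k ∣ j) → w j ≈ 0#)

  isStretch-resp : ∀ {k w w′ u u′} → (∀ j → w j ≈ w′ j) → (∀ m → u m ≈ u′ m) →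
                   IsStretch k w u → IsStretch k w′ u′
  isStretch-resp w≈w′ u≈u′ (w≈u , w≈0) = (λ m → trans (sym (w≈w′ _)) (trans (w≈u m) (u≈u′ m)))
                                        , (λ j k∤j → trans (sym (w≈w′ j)) (w≈0 j k∤j))

  +-isStretch : ∀ {k w u w′ u′} → IsStretch k w u → IsStretch k w′ u′ →
                IsStretch k (λ j → w j + w′ j) (λ m → u m + u′ m)
  +-isStretch (w≈u , w≈0) (w′≈u′ , w′≈0) = (λ m → +-cong (w≈u m) (w′≈u′ m))
                                         , (λ j k∤j → trans (+-cong (w≈0 j k∤j) (w′≈0 j k∤j)) (+-identityˡ 0#))

  isStretch-unique : ∀ {k w w′ u} .{{_ : ℕ.NonZero k}} → IsStretch k w u → IsStretch k w′ u → ∀ j → w j ≈ w′ j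
  isStretch-unique {k} (w≈u , w≈0) (w′≈u , w′≈0) j with k ∣? j
  ... | yes (divides-refl m) = trans (w≈u m) (sym (w′≈u m))
  ... | no  k∤j             = trans (w≈0 j k∤j) (sym (w′≈0 j k∤j))

  sumUpTo-sparse : ∀ {k g} .{{_ : ℕ.NonZero k}} → (∀ i → ¬ (k ∣ i) → g i ≈ 0#) →
                   ∀ m → sumUpTo g (m ℕ.* k) ≈ sumUpTo (λ j → g (j ℕ.* k)) m
  sumUpTo-sparse         g≈0 zero    = refl
  sumUpTo-sparse {suc k} {g} g≈0 (suc m) = begin
    sumUpTo g (suc m ℕ.* suc k)
      ≡⟨ ≡.cong (sumUpTo g) (ℕP.+-comm (suc k) (m ℕ.* suc k)) ⟩
    sumUpTo g (m ℕ.* suc k ℕ.+ suc k)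
      ≈⟨ sumUpTo-+ (m ℕ.* suc k) k ⟩
    sumUpTo g (m ℕ.* suc k) + sumUpTo (λ i → g (m ℕ.* suc k ℕ.+ suc i)) k
      ≈⟨ +-cong (sumUpTo-sparse g≈0 m) (sumUpTo-last k (λ i i<k → g≈0 _ (between-multiples (s≤s i<k)))) ⟩
    sumUpTo (λ j → g (j ℕ.* suc k)) m + g (m ℕ.* suc k ℕ.+ suc k)
      ≡⟨ ≡.cong (λ x → sumUpTo (λ j → g (j ℕ.* suc k)) m + g x) (ℕP.+-comm (m ℕ.* suc k) (suc k)) ⟩
    sumUpTo (λ j → g (j ℕ.* suc k)) (suc m)
      ∎
    where
    between-multiples : ∀ {r} → suc r ℕ.< suc k → ¬ (suc k ∣ m ℕ.* suc k ℕ.+ suc r)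
    between-multiples r<k k∣ = ℕP.<⇒≱ r<k (∣⇒≤ (∣m+n∣m⇒∣n k∣ (n∣m*n m)))

  ⊛-isStretch : ∀ {k w u z v} .{{_ : ℕ.NonZero k}} → IsStretch k w u → IsStretch k z v → IsStretch k (w ⊛ z) (u ⊛ v)
  ⊛-isStretch {k} {w} {u} {z} {v} (w≈u , w≈0) (z≈v , z≈0) = on-multiples , off-multiples
    where
    on-multiples : ∀ m → (w ⊛ z) (m ℕ.* k) ≈ (u ⊛ v) m
    on-multiples m = trans (sumUpTo-sparse (λ i k∤i → trans (*-congʳ (w≈0 i k∤i)) (zeroˡ _)) m)
      (sumUpTo-cong m (λ i _ → *-cong (w≈u i) (trans (reflexive (≡.cong z (≡.sym (ℕP.*-distribʳ-∸ k m i)))) (z≈v (m ℕ.∸ i)))))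
    off-multiples : ∀ j → ¬ (k ∣ j) → (w ⊛ z) j ≈ 0#
    off-multiples j k∤j = sumUpTo-zero j term≈0
      where
      term≈0 : ∀ i → i ≤ j → w i * z (j ℕ.∸ i) ≈ 0#
      term≈0 i i≤j with k ∣? i
      ... | yes k∣i = trans (*-congˡ (z≈0 _ (λ k∣j∸i → k∤j (∣m∸n∣n⇒∣m k i≤j k∣j∸i k∣i)))) (zeroʳ _)
      ... | no  k∤i = trans (*-congʳ (w≈0 i k∤i)) (zeroˡ _)

  isStretch-comm : ∀ {a b v′ v w x} .{{_ : ℕ.NonZero a}} .{{_ : ℕ.NonZero b}} →
                   IsStretch a v′ v → IsStretch b v w → IsStretch a x w → IsStretch b v′ x
  isStretch-comm {a} {b} {v′} {v} {w} {x} (v′≈v , v′≈0) (v≈w , v≈0) (x≈w , x≈0) = on-multiples , off-multiples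
    where
    on-multiples : ∀ m → v′ (m ℕ.* b) ≈ x m
    on-multiples m with a ∣? m
    ... | yes (divides-refl q) = begin
      v′ (q ℕ.* a ℕ.* b)   ≡⟨ ≡.cong v′ (m*n*o≡m*o*n q a b) ⟩
      v′ (q ℕ.* b ℕ.* a)   ≈⟨ v′≈v (q ℕ.* b) ⟩
      v (q ℕ.* b)          ≈⟨ v≈w q ⟩
      w q                  ≈⟨ sym (x≈w q) ⟩
      x (q ℕ.* a)          ∎
    ... | no a∤m with a ∣? m ℕ.* b
    ...   | no  a∤mb = trans (v′≈0 _ a∤mb) (sym (x≈0 m a∤m))
    ...   | yes (divides r mb≡ra) =
            trans (reflexive (≡.cong v′ mb≡ra)) (trans (v′≈v r) (trans (v≈0 r b∤r) (sym (x≈0 m a∤m))))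
      where
      b∤r : ¬ (b ∣ r)
      b∤r (divides-refl s) = a∤m (divides s (ℕP.*-cancelʳ-≡ m (s ℕ.* a) b
                               (≡.trans mb≡ra (m*n*o≡m*o*n s b a))))
    off-multiples : ∀ j → ¬ (b ∣ j) → v′ j ≈ 0#
    off-multiples j b∤j with a ∣? j
    ... | yes (divides-refl q) = trans (v′≈v q) (v≈0 q (λ b∣q → b∤j (∣m⇒∣m*n a b∣q)))
    ... | no  a∤j             = v′≈0 j a∤j

  SparseBelow : ℕ → ℕ → Seq → Set ℓ
  SparseBelow k n u = ∀ j → j ℕ.< n → ¬ (k ∣ j) → u j ≈ 0#

  sparseBelow-term : ∀ {k n u v i j} → SparseBelow k n u → SparseBelow k n v →
                     i ≤ j → i ℕ.< n → j ℕ.∸ i ℕ.< n → ¬ (k ∣ j) → u i * v (j ℕ.∸ i) ≈ 0#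
  sparseBelow-term {k} {i = i} u-sparse v-sparse i≤j i<n j∸i<n k∤j with k ∣? i
  ... | yes k∣i = trans (*-congˡ (v-sparse _ j∸i<n (λ k∣j∸i → k∤j (∣m∸n∣n⇒∣m k i≤j k∣j∸i k∣i)))) (zeroʳ _)
  ... | no  k∤i = trans (*-congʳ (u-sparse i i<n k∤i)) (zeroˡ _)

  ⊛-sparseBelow : ∀ {k n u v} → SparseBelow k n u → SparseBelow k n v → SparseBelow k n (u ⊛ v)
  ⊛-sparseBelow u-sparse v-sparse j j<n k∤j = sumUpTo-zero j (λ i i≤j →
    sparseBelow-term u-sparse v-sparse i≤j (ℕP.≤-<-trans i≤j j<n) (ℕP.≤-<-trans (ℕP.m∸n≤m j i) j<n) k∤j)

  ⊛-sparseBelow-at : ∀ {k n u v} → SparseBelow k n u → SparseBelow k n v → ¬ (k ∣ n) →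
                     (u ⊛ v) n ≈ u 0 * v n + u n * v 0
  ⊛-sparseBelow-at {k} {n} {u} {v} u-sparse v-sparse k∤n = begin
    (u ⊛ v) n                               ≈⟨ sumUpTo-ends n 1≤n middle≈0 ⟩
    u 0 * v n + u n * v (n ℕ.∸ n)           ≡⟨ ≡.cong (λ m → u 0 * v n + u n * v m) (ℕP.n∸n≡0 n) ⟩
    u 0 * v n + u n * v 0                   ∎
    where
    1≤n : 1 ≤ n
    1≤n = ℕP.n≢0⇒n>0 (λ { ≡.refl → k∤n (k ∣0) })
    middle≈0 : ∀ i → 1 ≤ i → i ℕ.< n → u i * v (n ℕ.∸ i) ≈ 0#
    middle≈0 i 1≤i i<n = sparseBelow-term u-sparse v-sparse (ℕP.<⇒≤ i<n) i<n (ℕP.∸-monoʳ-< 1≤i (ℕP.<⇒≤ i<n)) k∤n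

  -- Series are compared through their coefficients read downward from any exponent A above which they
  -- vanish, not only from the stored top (the top of a product or sum is rarely the useful bound).
  coeffsFrom : Series → ℤ → Seq
  coeffsFrom s A m = coeff s (A ℤ.- + m)

  VanishAbove : Series → ℤ → Set ℓ
  VanishAbove s A = ∀ j → coeff s (A ℤ.+ + suc j) ≈ 0#

  coeff-series : ∀ N a k n → N ℤ.- k ≡ + n → coeff (series N a) k ≡ a n
  coeff-series N a k n N-k≡n with N ℤ.- k | N-k≡n
  ... | + _ | ≡.refl = ≡.refl

  coeff-series-above : ∀ N a k j → N ℤ.- k ≡ -[1+ j ] → coeff (series N a) k ≡ 0#
  coeff-series-above N a k j N-k≡-[1+j] with N ℤ.- k | N-k≡-[1+j]
  ... | -[1+ _ ] | ≡.refl = ≡.refl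

  coeffsFrom-top : ∀ s m → coeffsFrom s (top s) m ≡ cf s m
  coeffsFrom-top s m = coeff-series (top s) (cf s) _ m (i-[i-j]≡j (top s) (+ m))

  vanishAbove-top : ∀ s → VanishAbove s (top s)
  vanishAbove-top s j = reflexive (coeff-series-above (top s) (cf s) _ j (i-[i+j]≡-j (top s) (+ suc j)))
    where
    i-[i+j]≡-j : ∀ i j → i ℤ.- (i ℤ.+ j) ≡ ℤ.- j
    i-[i+j]≡-j = solve-∀

  vanishAbove-+ : ∀ s A x → VanishAbove s A → VanishAbove s (A ℤ.+ + x)
  vanishAbove-+ s A x s≈0 j = trans (reflexive (≡.cong (coeff s) (≡.trans (ℤP.+-assoc A (+ x) (+ suc j))
                                                 (≡.cong (λ y → A ℤ.+ + y) (ℕP.+-suc x j)))))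
                                        (s≈0 (x ℕ.+ j))

  vanishAbove-mono : ∀ s {A B} → A ℤ.≤ B → VanishAbove s A → VanishAbove s B
  vanishAbove-mono s {A} A≤B s≈0 with ≤⇒≡+ A≤B
  ... | x , ≡.refl = vanishAbove-+ s A x s≈0

  vanishAbove-< : ∀ {s A k} → VanishAbove s A → A ℤ.< k → coeff s k ≈ 0#
  vanishAbove-< s≈0 A<k with <⇒≡+suc A<k
  ... | j , ≡.refl = s≈0 j

  coeffsFrom-shift : ∀ s A c m → coeffsFrom s (A ℤ.+ + c) (m ℕ.+ c) ≡ coeffsFrom s A m
  coeffsFrom-shift s A c m = ≡.cong (coeff s) ([i+k]-[j+k]≡i-j A (+ m) (+ c))
    where
    [i+k]-[j+k]≡i-j : ∀ i j k → (i ℤ.+ k) ℤ.- (j ℤ.+ k) ≡ i ℤ.- j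
    [i+k]-[j+k]≡i-j = solve-∀

  coeffsFrom-isShift : ∀ s A c → VanishAbove s A → IsShift c (coeffsFrom s (A ℤ.+ + c)) (coeffsFrom s A)
  coeffsFrom-isShift s A c s≈0 = leading , (λ m → reflexive (coeffsFrom-shift s A c m))
    where
    leading : ∀ i → i ℕ.< c → coeffsFrom s (A ℤ.+ + c) i ≈ 0#
    leading i i<c with ℕP.m≤n⇒∃[o]m+o≡n i<c
    ... | o , ≡.refl = trans (reflexive (≡.cong (coeff s) ([i+[1+j+k]]-j≡i+[1+k] A (+ i) (+ o)))) (s≈0 o)
      where
      [i+[1+j+k]]-j≡i+[1+k] : ∀ i j k → (i ℤ.+ (ℤ.+ 1 ℤ.+ (j ℤ.+ k))) ℤ.- j ≡ i ℤ.+ (ℤ.+ 1 ℤ.+ k)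
      [i+[1+j+k]]-j≡i+[1+k] = solve-∀

  top-isShift : ∀ s c → IsShift c (coeffsFrom s (top s ℤ.+ + c)) (cf s)
  top-isShift s c with coeffsFrom-isShift s (top s) c (vanishAbove-top s)
  ... | leading , shifted = leading , (λ m → trans (shifted m) (reflexive (coeffsFrom-top s m)))

  vanishAbove-lower : ∀ s B c → VanishAbove s (B ℤ.+ + c) → (∀ i → i ℕ.< c → coeffsFrom s (B ℤ.+ + c) i ≈ 0#) →
                      VanishAbove s B
  vanishAbove-lower s B c s≈0 leading≈0 j with <⊎≡+ j c
  ... | inj₂ (m , ≡.refl) = trans (reflexive (≡.cong (coeff s) (i+[1+j+k]≡[i+k]+[1+j] B (+ m) (+ c)))) (s≈0 m)
    where
    i+[1+j+k]≡[i+k]+[1+j] : ∀ i j k → i ℤ.+ (ℤ.+ 1 ℤ.+ (j ℤ.+ k)) ≡ (i ℤ.+ k) ℤ.+ (ℤ.+ 1 ℤ.+ j)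
    i+[1+j+k]≡[i+k]+[1+j] = solve-∀
  ... | inj₁ j<c with ℕP.m≤n⇒∃[o]m+o≡n j<c
  ...   | o , ≡.refl = trans (reflexive (≡.cong (coeff s) (≡.sym ([i+[1+j+k]]-k≡i+[1+j] B (+ j) (+ o)))))
                             (leading≈0 o (ℕP.m<n+m o (s≤s z≤n)))
    where
    [i+[1+j+k]]-k≡i+[1+j] : ∀ i j k → (i ℤ.+ (ℤ.+ 1 ℤ.+ (j ℤ.+ k))) ℤ.- k ≡ i ℤ.+ (ℤ.+ 1 ℤ.+ j)
    [i+[1+j+k]]-k≡i+[1+j] = solve-∀

  ≋-fromCoeffs : ∀ s s′ A → VanishAbove s A → VanishAbove s′ A →
                 (∀ m → coeffsFrom s A m ≈ coeffsFrom s′ A m) → s ≋ s′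
  ≋-fromCoeffs s s′ A s≈0 s′≈0 s≈s′ k with below-or-above A k
  ... | inj₁ (m , ≡.refl) = s≈s′ m
  ... | inj₂ (j , ≡.refl) = trans (s≈0 j) (sym (s′≈0 j))

  coeff≉0⇒top≥ : ∀ s a → ¬ (coeff s (+ a) ≈ 0#) → Σ ℕ λ c → top s ≡ + (a ℕ.+ c)
  coeff≉0⇒top≥ s a s[a]≉0 with below-or-above (top s) (+ a)
  ... | inj₁ (c , a≡top-c) = c , ≡.trans (i≡[i-j]+j (top s) (+ c)) (≡.cong (ℤ._+ + c) (≡.sym a≡top-c))
    where
    i≡[i-j]+j : ∀ i j → i ≡ (i ℤ.- j) ℤ.+ j
    i≡[i-j]+j = solve-∀
  ... | inj₂ (j , a≡top+j) = ⊥-elim (s[a]≉0 (trans (reflexive (≡.cong (coeff s) a≡top+j)) (vanishAbove-top s j)))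

  HasCoeffsFrom : Series → ℤ → Seq → Set ℓ
  HasCoeffsFrom s A u = VanishAbove s A × (∀ m → coeffsFrom s A m ≈ u m)

  *S-coeffsFrom : ∀ s s′ A A′ → VanishAbove s A → VanishAbove s′ A′ →
                  HasCoeffsFrom (s *S s′) (A ℤ.+ A′) (coeffsFrom s A ⊛ coeffsFrom s′ A′)
  *S-coeffsFrom s s′ A A′ s≈0 s′≈0
    with common-upper-bound A (top s) | common-upper-bound A′ (top s′)
  ... | a , b , A+a≡N+b | a′ , b′ , A′+a′≡N′+b′ =
      vanishAbove-lower Π (A ℤ.+ A′) (a ℕ.+ a′) Π≈0 (λ i i<a+a′ → trans (Π≈u⊛v i) (proj₁ u⊛v-shift i i<a+a′))
    , (λ m → trans (reflexive (≡.sym (coeffsFrom-shift Π (A ℤ.+ A′) (a ℕ.+ a′) m)))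
                   (trans (Π≈u⊛v _) (proj₂ u⊛v-shift m)))
    where
    -- Read from a common upper bound T of A + A′ and top s + top s′, both sides are shifts of cf s ⊛ cf s′.
    Π : Series
    Π = s *S s′
    T : ℤ
    T = (A ℤ.+ A′) ℤ.+ + (a ℕ.+ a′)

    [i+j]+[k+l]≡[i+k]+[j+l] : ∀ i j k l → (i ℤ.+ j) ℤ.+ (k ℤ.+ l) ≡ (i ℤ.+ k) ℤ.+ (j ℤ.+ l)
    [i+j]+[k+l]≡[i+k]+[j+l] = solve-∀

    T≡top+b+b′ : T ≡ top Π ℤ.+ + (b ℕ.+ b′)
    T≡top+b+b′ = ≡.trans ([i+j]+[k+l]≡[i+k]+[j+l] A A′ (+ a) (+ a′))
                 (≡.trans (≡.cong₂ ℤ._+_ A+a≡N+b A′+a′≡N′+b′) ([i+j]+[k+l]≡[i+k]+[j+l] (top s) (+ b) (top s′) (+ b′)))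

    u v : Seq
    u = coeffsFrom s (A ℤ.+ + a)
    v = coeffsFrom s′ (A′ ℤ.+ + a′)

    u⊛v-shift : IsShift (a ℕ.+ a′) (u ⊛ v) (coeffsFrom s A ⊛ coeffsFrom s′ A′)
    u⊛v-shift = ⊛-isShift (coeffsFrom-isShift s A a s≈0) (coeffsFrom-isShift s′ A′ a′ s′≈0)

    Π≈u⊛v : ∀ i → coeffsFrom Π T i ≈ (u ⊛ v) i
    Π≈u⊛v = isShift-unique
      (≡.subst (λ B → IsShift (b ℕ.+ b′) (coeffsFrom Π B) (cf Π)) (≡.sym T≡top+b+b′) (top-isShift Π (b ℕ.+ b′)))
      (⊛-isShift (≡.subst (λ B → IsShift b (coeffsFrom s B) (cf s)) (≡.sym A+a≡N+b) (top-isShift s b))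
                 (≡.subst (λ B → IsShift b′ (coeffsFrom s′ B) (cf s′)) (≡.sym A′+a′≡N′+b′) (top-isShift s′ b′)))

    Π≈0 : VanishAbove Π T
    Π≈0 = ≡.subst (VanishAbove Π) (≡.sym T≡top+b+b′) (vanishAbove-+ Π (top Π) (b ℕ.+ b′) (vanishAbove-top Π))

  +S-coeff : ∀ s s′ k → coeff (s +S s′) k ≈ coeff s k + coeff s′ k
  +S-coeff s s′ k with below-or-above (top s ℤ.⊔ top s′) k
  ... | inj₁ (m , ≡.refl) = reflexive (coeffsFrom-top (s +S s′) m)
  ... | inj₂ (j , ≡.refl) = begin
    coeff (s +S s′) (M ℤ.+ + suc j)                       ≈⟨ vanishAbove-top (s +S s′) j ⟩
    0#                                                    ≈⟨ sym (+-identityˡ 0#) ⟩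
    0# + 0#                                               ≈⟨ sym (+-cong (s≈0 j) (s′≈0 j)) ⟩
    coeff s (M ℤ.+ + suc j) + coeff s′ (M ℤ.+ + suc j)    ∎
    where
    M : ℤ
    M = top s ℤ.⊔ top s′
    s≈0 : VanishAbove s M
    s≈0 = vanishAbove-mono s (ℤP.i≤i⊔j (top s) (top s′)) (vanishAbove-top s)
    s′≈0 : VanishAbove s′ M
    s′≈0 = vanishAbove-mono s′ (ℤP.i≤j⊔i (top s) (top s′)) (vanishAbove-top s′)

  vanishAbove-+S : ∀ s s′ A → VanishAbove s A → VanishAbove s′ A → VanishAbove (s +S s′) A
  vanishAbove-+S s s′ A s≈0 s′≈0 j = trans (+S-coeff s s′ _) (trans (+-cong (s≈0 j) (s′≈0 j)) (+-identityˡ 0#))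

  vanishAbove-constS : ∀ a x → VanishAbove (constS a) (+ x)
  vanishAbove-constS a x = vanishAbove-+ (constS a) (+ 0) x (vanishAbove-top (constS a))

  coeffsFrom-constS-self : ∀ a x → coeffsFrom (constS a) (+ x) x ≈ a
  coeffsFrom-constS-self a x = reflexive (≡.cong (coeff (constS a)) (ℤP.+-inverseʳ (+ x)))

  coeffsFrom-constS-other : ∀ a x j → j ≢ x → coeffsFrom (constS a) (+ x) j ≈ 0#
  coeffsFrom-constS-other a x j j≢x with below-or-above (+ 0) (+ x ℤ.- + j)
  ... | inj₁ (zero  , x-j≡0) = ⊥-elim (j≢x (≡.sym (ℤP.+-injective (ℤP.i-j≡0⇒i≡j (+ x) (+ j) x-j≡0))))
  ... | inj₁ (suc _ , x-j≡-[1+i]) = reflexive (≡.cong (coeff (constS a)) x-j≡-[1+i])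
  ... | inj₂ (i , x-j≡1+i) = trans (reflexive (≡.cong (coeff (constS a)) x-j≡1+i)) (vanishAbove-top (constS a) i)

  *S-zeroS : ∀ s k → coeff (s *S zeroS) k ≈ 0#
  *S-zeroS s k with top s ℤ.+ + 0 ℤ.- k
  ... | + n      = sumUpTo-zero n (λ i _ → trans (*-congˡ (zeroS-cf (n ℕ.∸ i))) (zeroʳ _))
    where
    zeroS-cf : ∀ m → cf zeroS m ≈ 0#
    zeroS-cf zero    = refl
    zeroS-cf (suc _) = refl
  ... | -[1+ _ ] = refl

  evalS-const : ∀ a s k → coeff (evalS (a ∷ []) s) k ≈ coeff (constS a) k
  evalS-const a s k = trans (+S-coeff (constS a) (s *S zeroS) k) (trans (+-congˡ (*S-zeroS s k)) (+-identityʳ _))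

  vanishAbove-evalS-const : ∀ a s → VanishAbove (evalS (a ∷ []) s) (+ 0)
  vanishAbove-evalS-const a s j = trans (evalS-const a s _) (vanishAbove-constS a 0 j)

  horner-step : ∀ a s e x y → VanishAbove s (+ x) → VanishAbove e (+ y) →
                HasCoeffsFrom (constS a +S (s *S e)) (+ (x ℕ.+ y))
                              (λ j → coeffsFrom (constS a) (+ (x ℕ.+ y)) j + (coeffsFrom s (+ x) ⊛ coeffsFrom e (+ y)) j)
  horner-step a s e x y s≈0 e≈0 =
      vanishAbove-+S (constS a) (s *S e) (+ (x ℕ.+ y)) (vanishAbove-constS a (x ℕ.+ y)) (proj₁ se)
    , (λ j → trans (+S-coeff (constS a) (s *S e) _) (+-congˡ (proj₂ se j)))
    where
    se : HasCoeffsFrom (s *S e) (+ (x ℕ.+ y)) (coeffsFrom s (+ x) ⊛ coeffsFrom e (+ y))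
    se = *S-coeffsFrom s e (+ x) (+ y) s≈0 e≈0

  constS-isStretch : ∀ {k} .{{_ : ℕ.NonZero k}} a x →
                     IsStretch k (coeffsFrom (constS a) (+ (x ℕ.* k))) (coeffsFrom (constS a) (+ x))
  constS-isStretch {k} a x = on-multiples , off-multiples
    where
    on-multiples : ∀ m → coeffsFrom (constS a) (+ (x ℕ.* k)) (m ℕ.* k) ≈ coeffsFrom (constS a) (+ x) m
    on-multiples m with m ℕ.≟ x
    ... | yes ≡.refl = trans (coeffsFrom-constS-self a (m ℕ.* k)) (sym (coeffsFrom-constS-self a m))
    ... | no  m≢x    = trans (coeffsFrom-constS-other a _ _ (λ mk≡xk → m≢x (ℕP.*-cancelʳ-≡ m x k mk≡xk)))
                             (sym (coeffsFrom-constS-other a x m m≢x))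
    off-multiples : ∀ j → ¬ (k ∣ j) → coeffsFrom (constS a) (+ (x ℕ.* k)) j ≈ 0#
    off-multiples j k∤j = coeffsFrom-constS-other a _ j (λ { ≡.refl → k∤j (n∣m*n x) })

  compPow-cf-multiple : ∀ s k m → cf (compPow s (suc k)) (m ℕ.* suc k) ≡ cf s m
  compPow-cf-multiple s k m with m ℕ.* suc k ℕD.% suc k ℕ.≟ 0
  ... | yes _   = ≡.cong (cf s) (ℕD.m*n/n≡m m (suc k))
  ... | no  ≢0  = ⊥-elim (≢0 (ℕD.m*n%n≡0 m (suc k)))

  compPow-cf-other : ∀ s k j → ¬ (suc k ∣ j) → cf (compPow s (suc k)) j ≡ 0#
  compPow-cf-other s k j k∤j with j ℕD.% suc k ℕ.≟ 0
  ... | yes ≡0 = ⊥-elim (k∤j (m%n≡0⇒n∣m j (suc k) ≡0))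
  ... | no  _  = ≡.refl

  compPow-isStretch : ∀ s a c k → top s ≡ + (a ℕ.+ c) →
                      IsStretch (suc k) (coeffsFrom (compPow s (suc k)) (+ (suc k ℕ.* a))) (coeffsFrom s (+ a))
  compPow-isStretch s a c k top≡a+c = on-multiples , off-multiples
    where
    X : Series
    X = compPow s (suc k)

    coeffsFrom≡cf : ∀ n → coeffsFrom X (+ (suc k ℕ.* a)) n ≡ cf X (n ℕ.+ c ℕ.* suc k)
    coeffsFrom≡cf n = ≡.trans (≡.sym (coeffsFrom-shift X (+ (suc k ℕ.* a)) (c ℕ.* suc k) n))
                              (≡.trans (≡.cong (λ B → coeffsFrom X B (n ℕ.+ c ℕ.* suc k)) topX) (coeffsFrom-top X _))
      where
      topX : + (suc k ℕ.* a) ℤ.+ + (c ℕ.* suc k) ≡ top X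
      topX = ≡.trans (≡.cong (λ x → + (suc k ℕ.* a ℕ.+ x)) (ℕP.*-comm c (suc k)))
             (≡.trans (≡.cong +_ (≡.sym (ℕP.*-distribˡ-+ (suc k) a c)))
             (≡.trans (ℤP.pos-* (suc k) (a ℕ.+ c)) (≡.cong (λ N → + suc k ℤ.* N) (≡.sym top≡a+c))))

    on-multiples : ∀ m → coeffsFrom X (+ (suc k ℕ.* a)) (m ℕ.* suc k) ≈ coeffsFrom s (+ a) m
    on-multiples m = begin
      coeffsFrom X (+ (suc k ℕ.* a)) (m ℕ.* suc k)   ≡⟨ coeffsFrom≡cf (m ℕ.* suc k) ⟩
      cf X (m ℕ.* suc k ℕ.+ c ℕ.* suc k)             ≡⟨ ≡.cong (cf X) (≡.sym (ℕP.*-distribʳ-+ (suc k) m c)) ⟩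
      cf X ((m ℕ.+ c) ℕ.* suc k)                     ≡⟨ compPow-cf-multiple s k (m ℕ.+ c) ⟩
      cf s (m ℕ.+ c)                                 ≡⟨ ≡.sym (coeffsFrom-top s (m ℕ.+ c)) ⟩
      coeffsFrom s (top s) (m ℕ.+ c)                 ≡⟨ ≡.cong (λ B → coeffsFrom s B (m ℕ.+ c)) top≡a+c ⟩
      coeffsFrom s (+ a ℤ.+ + c) (m ℕ.+ c)           ≡⟨ coeffsFrom-shift s (+ a) c m ⟩
      coeffsFrom s (+ a) m                           ∎

    off-multiples : ∀ j → ¬ (suc k ∣ j) → coeffsFrom X (+ (suc k ℕ.* a)) j ≈ 0#
    off-multiples j k∤j = reflexive (≡.trans (coeffsFrom≡cf j) (compPow-cf-other s k _ k∤j+ck))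
      where
      k∤j+ck : ¬ (suc k ∣ j ℕ.+ c ℕ.* suc k)
      k∤j+ck k∣ = k∤j (∣m+n∣m⇒∣n (≡.subst (suc k ∣_) (ℕP.+-comm j (c ℕ.* suc k)) k∣) (n∣m*n c))

  evalS-isStretch : ∀ {k} .{{_ : ℕ.NonZero k}} {s s′} → VanishAbove s (+ k) → VanishAbove s′ (+ 1) →
                    IsStretch k (coeffsFrom s (+ k)) (coeffsFrom s′ (+ 1)) →
                    ∀ p e → HasDegree p e →
                    VanishAbove (evalS p s) (+ (e ℕ.* k)) × VanishAbove (evalS p s′) (+ e) ×
                    IsStretch k (coeffsFrom (evalS p s) (+ (e ℕ.* k))) (coeffsFrom (evalS p s′) (+ e))
  evalS-isStretch s≈0 s′≈0 s-stretch []          _       deg = ⊥-elim (deg refl)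
  evalS-isStretch s≈0 s′≈0 s-stretch (a ∷ [])    (suc _) deg = ⊥-elim (deg refl)
  evalS-isStretch s≈0 s′≈0 s-stretch (a ∷ _ ∷ _) zero    deg = ⊥-elim (deg refl)
  evalS-isStretch {s = s} {s′} s≈0 s′≈0 s-stretch (a ∷ []) zero _ =
      vanishAbove-evalS-const a s , vanishAbove-evalS-const a s′
    , isStretch-resp (λ j → sym (evalS-const a s _)) (λ m → sym (evalS-const a s′ _)) (constS-isStretch a 0)
  evalS-isStretch {k} {s = s} {s′} s≈0 s′≈0 s-stretch (a ∷ b ∷ q) (suc e) deg
    with evalS-isStretch {s = s} {s′} s≈0 s′≈0 s-stretch (b ∷ q) e deg
  ... | E≈0 , E′≈0 , E-stretch =
      proj₁ step , proj₁ step′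
    , isStretch-resp (λ j → sym (proj₂ step j)) (λ m → sym (proj₂ step′ m))
                     (+-isStretch (constS-isStretch a (suc e)) (⊛-isStretch s-stretch E-stretch))
    where
    step : HasCoeffsFrom (evalS (a ∷ b ∷ q) s) (+ (suc e ℕ.* k))
             (λ j → coeffsFrom (constS a) (+ (suc e ℕ.* k)) j + (coeffsFrom s (+ k) ⊛ coeffsFrom (evalS (b ∷ q) s) (+ (e ℕ.* k))) j)
    step = horner-step a s (evalS (b ∷ q) s) k (e ℕ.* k) s≈0 E≈0
    step′ : HasCoeffsFrom (evalS (a ∷ b ∷ q) s′) (+ suc e)
              (λ m → coeffsFrom (constS a) (+ suc e) m + (coeffsFrom s′ (+ 1) ⊛ coeffsFrom (evalS (b ∷ q) s′) (+ e)) m)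
    step′ = horner-step a s′ (evalS (b ∷ q) s′) 1 e s′≈0 E′≈0

  lead : Poly → Carrier
  lead []          = 0#
  lead (a ∷ [])    = a
  lead (_ ∷ b ∷ q) = lead (b ∷ q)

  lead-≉0 : ∀ p e → HasDegree p e → ¬ (lead p ≈ 0#)
  lead-≉0 []          _       deg = ⊥-elim (deg refl)
  lead-≉0 (a ∷ [])    zero    deg = deg
  lead-≉0 (a ∷ [])    (suc _) deg = ⊥-elim (deg refl)
  lead-≉0 (_ ∷ _ ∷ _) zero    deg = ⊥-elim (deg refl)
  lead-≉0 (_ ∷ b ∷ q) (suc e) deg = lead-≉0 (b ∷ q) e deg

  module SparseEvaluation {k} .{{_ : ℕ.NonZero k}} (s : Series) (s≈0 : VanishAbove s (+ k))
                          {n} (k∤n : ¬ (k ∣ n)) (s-sparse : SparseBelow k n (coeffsFrom s (+ k))) where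
    l : Seq
    l = coeffsFrom s (+ k)

    record SparseEval (p : Poly) (e : ℕ) : Set ℓ where
      E : Seq
      E = coeffsFrom (evalS p s) (+ (e ℕ.* k))
      field
        vanish   : VanishAbove (evalS p s) (+ (e ℕ.* k))
        leading  : E 0 ≈ lead p * l 0 ^ e
        sparse   : SparseBelow k n E
        -- the coefficient e·lead p·l₀^(e−1) of l n, times l₀ to avoid the exponent e − 1
        critical : E n * l 0 ≈ ι e * (lead p * l 0 ^ e) * l n

    evalS-sparse : ∀ p e → HasDegree p e → SparseEval p e
    evalS-sparse []          _       deg = ⊥-elim (deg refl)
    evalS-sparse (a ∷ [])    (suc _) deg = ⊥-elim (deg refl)
    evalS-sparse (_ ∷ _ ∷ _) zero    deg = ⊥-elim (deg refl)
    evalS-sparse (a ∷ [])    zero    _   = record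
      { vanish   = vanishAbove-evalS-const a s
      ; leading  = trans (evalS-const a s (+ 0 ℤ.- + 0)) (trans (coeffsFrom-constS-self a 0) (sym (*-identityʳ a)))
      ; sparse   = λ j _ k∤j → off-multiples j k∤j
      ; critical = trans (*-congʳ (off-multiples n k∤n)) (trans (zeroˡ _) (sym (trans (*-congʳ (zeroˡ _)) (zeroˡ _))))
      }
      where
      off-multiples : ∀ j → ¬ (k ∣ j) → coeffsFrom (evalS (a ∷ []) s) (+ 0) j ≈ 0#
      off-multiples j k∤j = trans (evalS-const a s (+ 0 ℤ.- + j)) (coeffsFrom-constS-other a 0 j (λ { ≡.refl → k∤j (k ∣0) }))
    evalS-sparse (a ∷ b ∷ q) (suc e) deg = record
      { vanish   = proj₁ step
      ; leading  = begin
          E′ 0                              ≈⟨ proj₂ step 0 ⟩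
          C 0 + l 0 * E 0                   ≈⟨ +-cong (coeffsFrom-constS-other a _ 0 0≢[1+e]k) (*-congˡ (leading IH)) ⟩
          0# + l 0 * (P * l 0 ^ e)          ≈⟨ +-identityˡ _ ⟩
          l 0 * (P * l 0 ^ e)               ≈⟨ Solver.solve 3 (λ x P Q → x :* (P :* Q) := P :* (x :* Q)) refl (l 0) P (l 0 ^ e) ⟩
          P * l 0 ^ suc e                   ∎
      ; sparse   = λ j j<n k∤j → trans (proj₂ step j)
                                   (trans (+-cong (C-off j k∤j) (⊛-sparseBelow s-sparse (sparse IH) j j<n k∤j)) (+-identityˡ 0#))
      ; critical = begin
          E′ n * l 0                                      ≈⟨ *-congʳ (proj₂ step n) ⟩
          (C n + (l ⊛ E) n) * l 0
            ≈⟨ *-congʳ (trans (+-cong (C-off n k∤n) (⊛-sparseBelow-at s-sparse (sparse IH) k∤n)) (+-identityˡ _)) ⟩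
          (l 0 * E n + l n * E 0) * l 0
            ≈⟨ Solver.solve 4 (λ x En y E0 → (x :* En :+ y :* E0) :* x := x :* (En :* x) :+ y :* E0 :* x)
                 refl (l 0) (E n) (l n) (E 0) ⟩
          l 0 * (E n * l 0) + l n * E 0 * l 0             ≈⟨ +-cong (*-congˡ (critical IH)) (*-congʳ (*-congˡ (leading IH))) ⟩
          l 0 * (ι e * (P * l 0 ^ e) * l n) + l n * (P * l 0 ^ e) * l 0
            ≈⟨ Solver.solve 5 (λ x i P Q y → x :* (i :* (P :* Q) :* y) :+ y :* (P :* Q) :* x
                                              := P :* (x :* Q) :* y :+ i :* (P :* (x :* Q) :* y))
                 refl (l 0) (ι e) P (l 0 ^ e) (l n) ⟩
          R + ι e * R                                     ≈⟨ sym (trans (distribʳ R 1# (ι e)) (+-congʳ (*-identityˡ R))) ⟩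
          (1# + ι e) * R                                  ≈⟨ sym (*-assoc _ _ _) ⟩
          ι (suc e) * (P * l 0 ^ suc e) * l n             ∎
      }
      where
      open SparseEval using (vanish; leading; sparse; critical)
      IH : SparseEval (b ∷ q) e
      IH = evalS-sparse (b ∷ q) e deg
      P R : Carrier
      P = lead (b ∷ q)
      R = P * l 0 ^ suc e * l n
      E E′ C : Seq
      E = coeffsFrom (evalS (b ∷ q) s) (+ (e ℕ.* k))
      E′ = coeffsFrom (evalS (a ∷ b ∷ q) s) (+ (suc e ℕ.* k))
      C = coeffsFrom (constS a) (+ (suc e ℕ.* k))
      step : HasCoeffsFrom (evalS (a ∷ b ∷ q) s) (+ (suc e ℕ.* k)) (λ j → C j + (l ⊛ E) j)
      step = horner-step a s (evalS (b ∷ q) s) k (e ℕ.* k) s≈0 (vanish IH)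
      0≢[1+e]k : 0 ≢ suc e ℕ.* k
      0≢[1+e]k 0≡[1+e]k = ℕP.1+n≢0 (ℕP.m*n≡0⇒m≡0 (suc e) k (≡.sym 0≡[1+e]k))
      C-off : ∀ j → ¬ (k ∣ j) → C j ≈ 0#
      C-off = proj₂ (constS-isStretch a (suc e))

  module FunctionalEquation (d′ D′ : ℕ) (f : Poly) (f-deg : HasDegree f (suc (suc d′)))
                            (L : Series) (L-val : V∞ L (+ suc D′)) (L-eqn : compPow L (suc (suc d′)) ≋ evalS f L)
                            (charZero : CharZero) where
    d D : ℕ
    d = suc (suc d′)
    D = suc D′

    l : Seq
    l = coeffsFrom L (+ D)

    L≈0 : VanishAbove L (+ D)
    L≈0 j = proj₂ L-val _ (ℤ.+<+ (ℕP.m<m+n D (s≤s z≤n)))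

    l0≉0 : ¬ (l 0 ≈ 0#)
    l0≉0 l0≈0 = proj₁ L-val (trans (reflexive (≡.cong (coeff L) (≡.sym (ℤP.+-identityʳ (+ D))))) l0≈0)

    L[t^d]-stretch : IsStretch d (coeffsFrom (compPow L d) (+ (d ℕ.* D))) l
    L[t^d]-stretch with coeff≉0⇒top≥ L D (proj₁ L-val)
    ... | c , top≡D+c = compPow-isStretch L D c (suc d′) top≡D+c

    l-sparse : ∀ n → ¬ (D ∣ n) → l n ≈ 0#
    l-sparse = <-rec (λ n → ¬ (D ∣ n) → l n ≈ 0#) step
      where
      step : ∀ n → (∀ {m} → m ℕ.< n → ¬ (D ∣ m) → l m ≈ 0#) → ¬ (D ∣ n) → l n ≈ 0#
      step n rec D∤n = x*y≈0⇒y≈0 critical≉0 (begin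
        ι d * (lead f * l 0 ^ d) * l n                         ≈⟨ sym (SparseEval.critical f[L]) ⟩
        coeffsFrom (evalS f L) (+ (d ℕ.* D)) n * l 0           ≈⟨ *-congʳ (sym (L-eqn _)) ⟩
        coeffsFrom (compPow L d) (+ (d ℕ.* D)) n * l 0         ≈⟨ *-congʳ L[t^d]≈0 ⟩
        0# * l 0                                               ≈⟨ zeroˡ _ ⟩
        0#                                                     ∎)
        where
        open SparseEvaluation L L≈0 D∤n (λ m m<n D∤m → rec m<n D∤m) using (SparseEval; evalS-sparse)
        f[L] : SparseEval f d
        f[L] = evalS-sparse f d f-deg

        critical≉0 : ¬ (ι d * (lead f * l 0 ^ d) ≈ 0#)
        critical≉0 = *-≉0 (charZero (suc d′)) (*-≉0 (lead-≉0 f d f-deg) (^-≉0 d l0≉0))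

        L[t^d]≈0 : coeffsFrom (compPow L d) (+ (d ℕ.* D)) n ≈ 0#
        L[t^d]≈0 with d ∣? n
        ... | no  d∤n             = proj₂ L[t^d]-stretch n d∤n
        ... | yes (divides-refl q) = trans (proj₁ L[t^d]-stretch q) (rec q<n D∤q)
          where
          q≢0 : q ≢ 0
          q≢0 ≡.refl = D∤n (D ∣0)
          q<n : q ℕ.< q ℕ.* d
          q<n = ℕP.m<m*n q d {{ℕ.≢-nonZero q≢0}} (s≤s (s≤s z≤n))
          D∤q : ¬ (D ∣ q)
          D∤q D∣q = D∤n (∣m⇒∣m*n d D∣q)

    ψ : Series
    ψ = series (+ 1) (λ m → l (m ℕ.* D))

    L-stretch : IsStretch D l (coeffsFrom ψ (+ 1))
    L-stretch = (λ m → sym (reflexive (coeffsFrom-top ψ m))) , l-sparse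

    ψ[t^k] : ∀ k → VanishAbove (compPow ψ (suc k)) (+ suc k) ×
                   IsStretch (suc k) (coeffsFrom (compPow ψ (suc k)) (+ suc k)) (coeffsFrom ψ (+ 1))
    ψ[t^k] k = ≡.subst (λ x → VanishAbove (compPow ψ (suc k)) (+ x) ×
                              IsStretch (suc k) (coeffsFrom (compPow ψ (suc k)) (+ x)) (coeffsFrom ψ (+ 1)))
                       (ℕP.*-identityʳ (suc k))
                       (vanishAbove-top (compPow ψ (suc k)) , compPow-isStretch ψ 1 0 k ≡.refl)

    ψ-val : V∞ ψ (+ 1)
    ψ-val = l0≉0 , λ k 1<k → vanishAbove-< {ψ} (vanishAbove-top ψ) 1<k

    L[t^d]-stretch-ψ[t^d] : IsStretch D (coeffsFrom (compPow L d) (+ (d ℕ.* D))) (coeffsFrom (compPow ψ d) (+ d))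
    L[t^d]-stretch-ψ[t^d] = isStretch-comm L[t^d]-stretch L-stretch (proj₂ (ψ[t^k] (suc d′)))

    f[L]-stretch-f[ψ] : VanishAbove (evalS f ψ) (+ d) ×
                        IsStretch D (coeffsFrom (evalS f L) (+ (d ℕ.* D))) (coeffsFrom (evalS f ψ) (+ d))
    f[L]-stretch-f[ψ] = proj₂ (evalS-isStretch L≈0 (vanishAbove-top ψ) L-stretch f d f-deg)

    ψ-eqn : compPow ψ d ≋ evalS f ψ
    ψ-eqn = ≋-fromCoeffs (compPow ψ d) (evalS f ψ) (+ d) (proj₁ (ψ[t^k] (suc d′))) (proj₁ f[L]-stretch-f[ψ]) λ m → begin
      coeffsFrom (compPow ψ d) (+ d) m                   ≈⟨ sym (proj₁ L[t^d]-stretch-ψ[t^d] m) ⟩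
      coeffsFrom (compPow L d) (+ (d ℕ.* D)) (m ℕ.* D)   ≈⟨ L-eqn _ ⟩
      coeffsFrom (evalS f L) (+ (d ℕ.* D)) (m ℕ.* D)     ≈⟨ proj₁ (proj₂ f[L]-stretch-f[ψ]) m ⟩
      coeffsFrom (evalS f ψ) (+ d) m                     ∎

    L≋ψ[t^D] : L ≋ compPow ψ D
    L≋ψ[t^D] = ≋-fromCoeffs L (compPow ψ D) (+ D) L≈0 (proj₁ (ψ[t^k] D′)) (isStretch-unique L-stretch (proj₂ (ψ[t^k] D′)))

lemma2p1 : ∀ {c ℓ : Level} (K : Field c ℓ) → let open Field K in let open Over K in
    AlgClosed → CharZero →
    (f : Poly) (d : ℕ) → HasDegree f d → 2 ≤ d →
    (D : ℕ) → 1 ≤ D →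
    (L : Series) → V∞ L (+ D) → compPow L d ≋ evalS f L →
    ∃ λ (ψ : Series) → V∞ ψ (+ 1) × (compPow ψ d ≋ evalS f ψ) × (L ≋ compPow ψ D)
lemma2p1 K _ charZero f (suc (suc d′)) f-deg (s≤s (s≤s _)) (suc D′) (s≤s _) L L-val L-eqn = ψ , ψ-val , ψ-eqn , L≋ψ[t^D]
  where open Laurent.FunctionalEquation K d′ D′ f f-deg L L-val L-eqn charZero
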